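{- Let $L$ be a finite semimodular lattice whose Hasse diagram has $e$ edges (covering pairs), and let $n$ be the number of its join-irreducible elements. Then the join-irreducible elements can be named $1,2,\ldots,n$ in such a way that the following procedure outputs exactly $e$ subtraction instructions: first output ``$f(x)\leftarrow g(x)$'' for every $x\in L$; then for $i=n,n-1,\ldots,1$ in turn, for every $x\in L$ with $x\not\ge i$, set $y = x\vee i$, and if $\varphi_{i-1}(x)=\varphi_{i-1}(y)$, output the subtraction instruction ``$f(y)\leftarrow f(y)-f(x)$''.
   Context: The covering relation $x\lessdot y$ means $x<y$ with no element strictly between; edges are the covering pairs. An element is join-irreducible if it covers exactly one element. A lattice is (upper) semimodular if for any two elements $x,y$ such that $x$ covers $x\wedge y$, the join $x\vee y$ covers $y$. With the join-irreducible elements named $1,\ldots,n$, the prefix spectrum map is $\varphi_i(x)=\{h\in\{1,\ldots,i\}: h\le x\}$ for $0\le i\le n$ (so $\varphi_0(x)=\varnothing$). The procedure produces a straight-line program (intended to compute the Möbius transform, i.e. recover $f:L\to A$, $A$ an abelian group, from $g(y)=\sum_{x\le y}f(x)$). -}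

module Defs where

open import Level using (0ℓ)
open import Data.Nat using (ℕ)
open import Data.Fin using (Fin; toℕ; _≟_)
open import Data.Fin.Properties using (all?)
import Data.Nat as ℕ
open import Data.Bool using (Bool; true; false)
open import Data.Product using (_×_; _,_; proj₁; proj₂; ∃)
open import Data.List using (List; []; _∷_; _++_; length; filter; map; concatMap; allFin; reverse; cartesianProduct)
open import Relation.Nullary using (¬_; Dec; yes; no; does)
open import Relation.Nullary.Decidable using (_×-dec_; ¬?; _→-dec_)
open import Relation.Binary using (Rel; Decidable)
open import Relation.Binary.PropositionalEquality using (_≡_)
open import Relation.Binary.Lattice.Structures using (IsLattice)
open import Function.Definitions using (Injective)

record FiniteLattice : Set₁ where
  field
    m         : ℕ
    _≤_       : Rel (Fin m) 0ℓ
    _≤?_      : Decidable _≤_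
    _∨_       : Fin m → Fin m → Fin m
    _∧_       : Fin m → Fin m → Fin m
    isLattice : IsLattice _≡_ _≤_ _∨_ _∧_

  _<_ : Fin m → Fin m → Set
  x < y = (x ≤ y) × ¬ (x ≡ y)

  _<?_ : Decidable _<_
  x <? y = (x ≤? y) ×-dec ¬? (x ≟ y)

  _⋖_ : Fin m → Fin m → Set
  x ⋖ y = (x < y) × (∀ z → ¬ ((x < z) × (z < y)))

  _⋖?_ : Decidable _⋖_
  x ⋖? y = (x <? y) ×-dec all? (λ z → ¬? ((x <? z) ×-dec (z <? y)))

  edges : ℕ
  edges = length (filter (λ p → proj₁ p ⋖? proj₂ p) (cartesianProduct (allFin m) (allFin m)))

  lowerCovers : Fin m → List (Fin m)
  lowerCovers x = filter (λ z → z ⋖? x) (allFin m)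

  JoinIrreducible : Fin m → Set
  JoinIrreducible x = length (lowerCovers x) ≡ 1

  JoinIrreducible? : (x : Fin m) → Dec (JoinIrreducible x)
  JoinIrreducible? x = length (lowerCovers x) ℕ.≟ 1

  numJI : ℕ
  numJI = length (filter JoinIrreducible? (allFin m))

  Semimodular : Set
  Semimodular = ∀ x y → (x ∧ y) ⋖ x → y ⋖ (x ∨ y)

  -- A naming of the join-irreducibles by 1..n, represented 0-based:
  -- ι k is the join-irreducible named (toℕ k + 1).
  IsNaming : (n : ℕ) → (Fin n → Fin m) → Set
  IsNaming n ι = Injective _≡_ _≡_ ι
               × (∀ k → JoinIrreducible (ι k))
               × (∀ x → JoinIrreducible x → ∃ λ k → ι k ≡ x)

  -- φ_{i-1}(x) = φ_{i-1}(y) where i = toℕ k + 1: the join-irreducibles named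
  -- h ≤ i-1 (0-based index h with toℕ h < toℕ k) below x are the same as below y.
  SamePrefixSpectrum : ∀ {n} → (Fin n → Fin m) → Fin n → Fin m → Fin m → Set
  SamePrefixSpectrum ι k x y =
    ∀ h → toℕ h ℕ.< toℕ k → ((ι h ≤ x → ι h ≤ y) × (ι h ≤ y → ι h ≤ x))

  SamePrefixSpectrum? : ∀ {n} (ι : Fin n → Fin m) k x y → Dec (SamePrefixSpectrum ι k x y)
  SamePrefixSpectrum? ι k x y =
    all? (λ h → (toℕ h ℕ.<? toℕ k) →-dec
                 (((ι h ≤? x) →-dec (ι h ≤? y)) ×-dec ((ι h ≤? y) →-dec (ι h ≤? x))))

data Instr (m : ℕ) : Set where
  assign : Fin m → Instr m              -- f(x) ← g(x)
  sub    : Fin m → Fin m → Instr m      -- sub y x :  f(y) ← f(y) - f(x)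

isSub : ∀ {m} → Instr m → Bool
isSub (assign _) = false
isSub (sub _ _)  = true

isSub? : ∀ {m} → (ins : Instr m) → Dec (isSub ins ≡ true)
isSub? (assign _) = no (λ ())
isSub? (sub _ _)  = yes Relation.Binary.PropositionalEquality.refl

module _ (L : FiniteLattice) where
  open FiniteLattice L

  -- The instructions emitted in round i (i = toℕ k + 1).
  round : ∀ {n} → (Fin n → Fin m) → Fin n → List (Instr m)
  round ι k = concatMap emit (allFin m)
    where
      emit : Fin m → List (Instr m)
      emit x with does (ι k ≤? x)
      ... | true  = []
      ... | false with does (SamePrefixSpectrum? ι k x (x ∨ ι k))
      ...   | true  = sub (x ∨ ι k) x ∷ []
      ...   | false = []

  procedure : ∀ {n} → (Fin n → Fin m) → List (Instr m)
  procedure {n} ι = map assign (allFin m) ++ concatMap (round ι) (reverse (allFin n))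

  numSubtractions : ∀ {n} → (Fin n → Fin m) → ℕ
  numSubtractions ι = length (filter isSub? (procedure ι))

module Submission where

-- Name the join-irreducibles along a linear extension of the order (sort them
-- by the size of their down-sets).  The round of the join-irreducible ι k
-- emits one subtraction for every x with a "step": ι k ≰ x, and x and x ∨ ι k
-- lie above the same join-irreducibles named before ι k.
-- For each x, the map k ↦ x ∨ ι k is a bijection from the steps at x onto the
-- upper covers of x: a step reaches a cover by semimodularity, every cover
-- x ⋖ y is reached by the join-irreducible of least name below y but not
-- below x, and two steps at x reaching the same element coincide.  Summing
-- over x, the number of subtractions equals the number of covering pairs.

open import Defs
open import Data.Fin using (Fin; toℕ)
import Data.Nat as ℕ
open import Data.Product using (∃; _×_; _,_; proj₁; proj₂)
open import Relation.Binary.PropositionalEquality using (_≡_; sym; module ≡-Reasoning)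

module Counting where

  open import Level using (Level)
  open import Data.Bool using (true; false; if_then_else_)
  open import Data.Nat using (ℕ; zero; suc; _+_; _<_; _≤_; z≤n; s≤s)
  open import Data.Nat.Properties
    using (+-0-commutativeMonoid; +-mono-≤; +-mono-<-≤; +-mono-≤-<; ≤-refl)
  open import Data.Nat.Induction using (<-wellFounded)
  import Data.Nat.ListAction as List
  open import Data.Fin using (zero; suc; punchIn; _≟_)
  open import Data.Fin.Properties using (any?; punchInᵢ≢i)
  open import Data.List
    using (List; []; _∷_; _++_; length; filter; map; concatMap; allFin; tabulate; cartesianProduct)
  open import Data.List.Properties using (filter-++; length-++; map-tabulate; map-cong)
  open import Function using (_∘_; id)
  open import Induction.WellFounded using (WellFounded; Acc; acc)
  import Induction.WellFounded as WF
  import Relation.Binary.Construct.On as On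
  open import Relation.Binary using (Rel)
  open import Relation.Binary.PropositionalEquality using (refl; trans; cong; cong₂; subst₂)
  open import Relation.Nullary using (¬_; Dec; yes; no; does; contradiction)
  open import Relation.Nullary.Decidable using (dec-true; dec-false; _×-dec_)
  open import Relation.Unary using (Pred; Decidable)
  open import Algebra.Properties.CommutativeMonoid.Sum +-0-commutativeMonoid public
    using (sum; sum-cong-≗; sum-remove; sum-replicate-zero; ∑-comm)

  private variable
    a p q r : Level
    A : Set a
    m n : ℕ

  𝟙 : {P : Set p} → Dec P → ℕ
  𝟙 d = if does d then 1 else 0

  𝟙-yes : {P : Set p} (d : Dec P) → P → 𝟙 d ≡ 1
  𝟙-yes d x = cong (λ b → if b then 1 else 0) (dec-true d x)

  𝟙-no : {P : Set p} (d : Dec P) → ¬ P → 𝟙 d ≡ 0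
  𝟙-no d ¬x = cong (λ b → if b then 1 else 0) (dec-false d ¬x)

  𝟙-mono : {P : Set p} {Q : Set q} (d : Dec P) (e : Dec Q) → (P → Q) → 𝟙 d ≤ 𝟙 e
  𝟙-mono (yes _) (yes _) _   = ≤-refl
  𝟙-mono (yes x) (no ¬y) P⇒Q = contradiction (P⇒Q x) ¬y
  𝟙-mono (no _)  _       _   = z≤n

  count : {P : Pred (Fin n) p} → Decidable P → ℕ
  count P? = sum (λ i → 𝟙 (P? i))

  sum-zero : {f : Fin n → ℕ} → (∀ i → f i ≡ 0) → sum f ≡ 0
  sum-zero {n} f≡0 = trans (sum-cong-≗ f≡0) (sum-replicate-zero n)

  sum-mono : {f g : Fin n → ℕ} → (∀ i → f i ≤ g i) → sum f ≤ sum g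
  sum-mono {zero}  _   = z≤n
  sum-mono {suc n} f≤g = +-mono-≤ (f≤g zero) (sum-mono (f≤g ∘ suc))

  sum-mono-< : {f g : Fin n → ℕ} → (∀ i → f i ≤ g i) → ∀ k → f k < g k → sum f < sum g
  sum-mono-< f≤g zero    fk<gk = +-mono-<-≤ fk<gk (sum-mono (f≤g ∘ suc))
  sum-mono-< f≤g (suc k) fk<gk = +-mono-≤-< (f≤g zero) (sum-mono-< (f≤g ∘ suc) k fk<gk)

  count-none : {P : Pred (Fin n) p} (P? : Decidable P) → (∀ i → ¬ P i) → count P? ≡ 0
  count-none P? none = sum-zero (λ i → 𝟙-no (P? i) (none i))

  count-unique : {P : Pred (Fin n) p} (P? : Decidable P) {k : Fin n} →
                 P k → (∀ i → P i → i ≡ k) → count P? ≡ 1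
  count-unique {n = suc n} P? {k} Pk unique = begin
    count P?                                      ≡⟨ sum-remove (λ i → 𝟙 (P? i)) ⟩
    𝟙 (P? k) + sum (λ i → 𝟙 (P? (punchIn k i)))   ≡⟨ cong₂ _+_ (𝟙-yes (P? k) Pk) (sum-zero others) ⟩
    1                                             ∎
    where
    open ≡-Reasoning
    others : ∀ i → 𝟙 (P? (punchIn k i)) ≡ 0
    others i = 𝟙-no (P? (punchIn k i)) (punchInᵢ≢i k i ∘ unique (punchIn k i))

  count-subsingleton : {P : Pred (Fin n) p} {S : Set q} (P? : Decidable P) →
                       (∀ {i j} → P i → P j → i ≡ j) → (S? : Dec S) →
                       (S → ∃ P) → (∃ P → S) → count P? ≡ 𝟙 S?
  count-subsingleton P? atMostOne (yes s) witness _ with witness s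
  ... | k , Pk = count-unique P? Pk (λ i Pi → atMostOne Pi Pk)
  count-subsingleton P? _ (no ¬s) _ holds = count-none P? (λ i Pi → ¬s (holds (i , Pi)))

  -- Both sides equal
  -- the number of pairs (k , y) with P k and g k ≡ y, summed in either order.
  count-bijection : {P : Pred (Fin m) p} {Q : Pred (Fin n) q}
                    (P? : Decidable P) (Q? : Decidable Q) (g : Fin m → Fin n) →
                    (∀ {k} → P k → Q (g k)) →
                    (∀ {y} → Q y → ∃ λ k → P k × g k ≡ y) →
                    (∀ {k k′} → P k → P k′ → g k ≡ g k′ → k ≡ k′) →
                    count Q? ≡ count P?
  count-bijection {P = P} P? Q? g into onto injective = begin
    sum (λ y → 𝟙 (Q? y))                       ≡⟨ sum-cong-≗ (λ y → sym (fibre y)) ⟩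
    sum (λ y → sum (λ k → 𝟙 (Graph? k y)))     ≡⟨ sym (∑-comm (λ k y → 𝟙 (Graph? k y))) ⟩
    sum (λ k → sum (λ y → 𝟙 (Graph? k y)))     ≡⟨ sum-cong-≗ image ⟩
    sum (λ k → 𝟙 (P? k))                       ∎
    where
    open ≡-Reasoning
    Graph? : ∀ k y → Dec (P k × g k ≡ y)
    Graph? k y = P? k ×-dec (g k ≟ y)
    fibre : ∀ y → count (λ k → Graph? k y) ≡ 𝟙 (Q? y)
    fibre y = count-subsingleton (λ k → Graph? k y)
                (λ (Pk , gk≡y) (Pk′ , gk′≡y) → injective Pk Pk′ (trans gk≡y (sym gk′≡y)))
                (Q? y) onto (λ { (k , Pk , refl) → into Pk })
    image : ∀ k → count (Graph? k) ≡ 𝟙 (P? k)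
    image k = count-subsingleton (Graph? k) (λ (_ , gk≡y) (_ , gk≡y′) → trans (sym gk≡y) gk≡y′)
                (P? k) (λ Pk → g k , Pk , refl) (λ (_ , Pk , _) → Pk)

  count-< : {P : Pred (Fin n) p} {Q : Pred (Fin n) q} (P? : Decidable P) (Q? : Decidable Q) →
            (∀ {i} → P i → Q i) → ∀ k → Q k → ¬ P k → count P? < count Q?
  count-< P? Q? P⇒Q k Qk ¬Pk =
    sum-mono-< (λ i → 𝟙-mono (P? i) (Q? i) P⇒Q) k
      (subst₂ _<_ (sym (𝟙-no (P? k) ¬Pk)) (sym (𝟙-yes (Q? k) Qk)) (s≤s z≤n))

  measure-wellFounded : {R : Rel A r} (μ : A → ℕ) → (∀ {x y} → R x y → μ x < μ y) → WellFounded R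
  measure-wellFounded μ increasing =
    WF.Subrelation.wellFounded increasing (On.wellFounded μ <-wellFounded)

  minimal : {R : Rel (Fin n) r} {Q : Pred (Fin n) q} → WellFounded R →
            (∀ x y → Dec (R x y)) → Decidable Q → ∀ {x} → Q x →
            ∃ λ z → Q z × (∀ w → R w z → ¬ Q w)
  minimal {R = R} {Q} wf R? Q? {x} Qx = descend x (wf x) Qx
    where
    descend : ∀ x → Acc R x → Q x → ∃ λ z → Q z × (∀ w → R w z → ¬ Q w)
    descend x (acc smaller) Qx with any? (λ w → R? w x ×-dec Q? w)
    ... | yes (w , Rwx , Qw) = descend w (smaller Rwx) Qw
    ... | no  none           = x , Qx , λ w Rwx Qw → none (w , Rwx , Qw)

  length-filter-sum : {P : Pred A p} (P? : Decidable P) (xs : List A) →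
                      length (filter P? xs) ≡ List.sum (map (𝟙 ∘ P?) xs)
  length-filter-sum P? []       = refl
  length-filter-sum P? (x ∷ xs) with does (P? x)
  ... | true  = cong suc (length-filter-sum P? xs)
  ... | false = length-filter-sum P? xs

  sum-allFin : (f : Fin n → ℕ) → List.sum (map f (allFin n)) ≡ sum f
  sum-allFin f = trans (cong List.sum (map-tabulate id f)) (sum-tabulate f)
    where
    sum-tabulate : ∀ {n} (f : Fin n → ℕ) → List.sum (tabulate f) ≡ sum f
    sum-tabulate {zero}  f = refl
    sum-tabulate {suc n} f = cong (f zero +_) (sum-tabulate (f ∘ suc))

  length-filter-allFin : {P : Pred (Fin n) p} (P? : Decidable P) →
                         length (filter P? (allFin n)) ≡ count P?
  length-filter-allFin P? = trans (length-filter-sum P? (allFin _)) (sum-allFin (𝟙 ∘ P?))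

  length-filter-concatMap : {B : Set a} {P : Pred B p} (P? : Decidable P) (f : A → List B) (xs : List A) →
                            length (filter P? (concatMap f xs))
                            ≡ List.sum (map (λ x → length (filter P? (f x))) xs)
  length-filter-concatMap P? f []       = refl
  length-filter-concatMap P? f (x ∷ xs) = begin
    length (filter P? (f x ++ concatMap f xs))
      ≡⟨ cong length (filter-++ P? (f x) _) ⟩
    length (filter P? (f x) ++ filter P? (concatMap f xs))
      ≡⟨ length-++ (filter P? (f x)) ⟩
    length (filter P? (f x)) + length (filter P? (concatMap f xs))
      ≡⟨ cong (_ +_) (length-filter-concatMap P? f xs) ⟩
    length (filter P? (f x)) + List.sum (map (λ x → length (filter P? (f x))) xs) ∎
    where open ≡-Reasoning

  length-filter-map : {B : Set a} {P : Pred B p} (P? : Decidable P) (g : A → B) (xs : List A) →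
                      length (filter P? (map g xs)) ≡ length (filter (P? ∘ g) xs)
  length-filter-map P? g []       = refl
  length-filter-map P? g (x ∷ xs) with does (P? (g x))
  ... | true  = cong suc (length-filter-map P? g xs)
  ... | false = length-filter-map P? g xs

  length-filter-pairs : {R : Fin m × Fin n → Set r} (R? : Decidable R) →
                        length (filter R? (cartesianProduct (allFin m) (allFin n)))
                        ≡ sum (λ x → count (λ y → R? (x , y)))
  length-filter-pairs {m} {n} R? = begin
    length (filter R? (cartesianProduct (allFin m) (allFin n)))
      ≡⟨ cong (length ∘ filter R?) (rows (allFin m)) ⟩
    length (filter R? (concatMap row (allFin m)))
      ≡⟨ length-filter-concatMap R? row (allFin m) ⟩
    List.sum (map (λ x → length (filter R? (row x))) (allFin m))
      ≡⟨ cong List.sum (map-cong row-count (allFin m)) ⟩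
    List.sum (map (λ x → count (λ y → R? (x , y))) (allFin m))
      ≡⟨ sum-allFin (λ x → count (λ y → R? (x , y))) ⟩
    sum (λ x → count (λ y → R? (x , y)))  ∎
    where
    open ≡-Reasoning
    row : Fin m → List (Fin m × Fin n)
    row x = map (x ,_) (allFin n)
    rows : ∀ xs → cartesianProduct xs (allFin n) ≡ concatMap row xs
    rows []       = refl
    rows (x ∷ xs) = cong (row x ++_) (rows xs)
    row-count : ∀ x → length (filter R? (row x)) ≡ count (λ y → R? (x , y))
    row-count x = trans (length-filter-map R? (x ,_) (allFin n)) (length-filter-allFin (λ y → R? (x , y)))

module Enumeration where

  open import Level using (Level)
  open import Data.Nat using (ℕ; _<_; _≤_; _<?_)
  open import Data.Nat.Properties using (≤-decTotalOrder; <⇒≱; ≮⇒≥)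
  open import Data.Fin using (zero; suc; cast)
  open import Data.Fin.Properties using (toℕ-cast; cast-involutive)
  open import Data.List using (List; _∷_; length; filter; allFin; lookup)
  import Data.List.Relation.Unary.All as All
  import Data.List.Relation.Unary.Any as Any
  open import Data.List.Relation.Unary.Any.Properties using (lookup-index)
  open import Data.List.Relation.Unary.AllPairs using (_∷_)
  open import Data.List.Relation.Unary.Unique.Propositional using (Unique)
  import Data.List.Relation.Unary.Unique.Propositional.Properties as Unique
  open import Data.List.Relation.Binary.Permutation.Propositional using (↭-sym; ↭⇒↭ₛ)
  open import Data.List.Relation.Binary.Permutation.Propositional.Properties using (∈-resp-↭; ↭-length)
  import Data.List.Relation.Binary.Permutation.Setoid.Properties as Permutation
  open import Data.List.Membership.Propositional using (_∈_)
  open import Data.List.Membership.Propositional.Properties using (∈-lookup; ∈-filter⁻; ∈-filter⁺; ∈-allFin)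
  import Data.List.Sort as Sort
  import Data.List.Relation.Unary.Sorted.TotalOrder.Properties as Sorted
  open import Function.Definitions using (Injective)
  import Relation.Binary.Construct.On as On
  open import Relation.Binary.Bundles using (DecTotalOrder)
  open import Relation.Binary.PropositionalEquality using (refl; trans; cong; subst₂; setoid)
  open import Relation.Nullary using (contradiction)
  open import Relation.Nullary.Decidable using (decidable-stable)
  open import Relation.Unary using (Pred; Decidable)

  private variable
    a p : Level
    A : Set a

  lookup-injective : {xs : List A} → Unique xs → ∀ i j → lookup xs i ≡ lookup xs j → i ≡ j
  lookup-injective {xs = x ∷ xs} _            zero    zero    _  = refl
  lookup-injective {xs = x ∷ xs} (x∉xs ∷ _)   zero    (suc j) eq =
    contradiction eq (All.lookup x∉xs (∈-lookup j))
  lookup-injective {xs = x ∷ xs} (x∉xs ∷ _)   (suc i) zero    eq =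
    contradiction (sym eq) (All.lookup x∉xs (∈-lookup i))
  lookup-injective {xs = x ∷ xs} (_ ∷ unique) (suc i) (suc j) eq =
    cong suc (lookup-injective unique i j eq)

  sorted-enumeration : ∀ {m} {J : Pred (Fin m) p} (J? : Decidable J) (μ : Fin m → ℕ) →
    ∃ λ (e : Fin (length (filter J? (allFin m))) → Fin m) →
      (Injective _≡_ _≡_ e × (∀ k → J (e k)) × (∀ x → J x → ∃ λ k → e k ≡ x)) ×
      (∀ h k → μ (e h) < μ (e k) → toℕ h < toℕ k)
  sorted-enumeration {m = m} {J = J} J? μ = e , (e-injective , e-in-J , e-onto) , e-monotone
    where
    byMeasure : DecTotalOrder _ _ _
    byMeasure = On.decTotalOrder ≤-decTotalOrder μ
    open Sort byMeasure using (sort; sort-↭; sort-↗)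

    members : List (Fin m)
    members = filter J? (allFin m)

    sorted : List (Fin m)
    sorted = sort members

    same-length : length sorted ≡ length members
    same-length = ↭-length (sort-↭ members)

    position : Fin (length members) → Fin (length sorted)
    position = cast (sym same-length)

    e : Fin (length members) → Fin m
    e k = lookup sorted (position k)

    sorted-unique : Unique sorted
    sorted-unique = Permutation.Unique-resp-↭ (setoid (Fin m)) (↭⇒↭ₛ (↭-sym (sort-↭ members)))
                      (Unique.filter⁺ J? (Unique.allFin⁺ m))

    e-injective : Injective _≡_ _≡_ e
    e-injective {h} {k} eh≡ek = begin
      h                               ≡⟨ cast-involutive same-length (sym same-length) h ⟨
      cast same-length (position h)   ≡⟨ cong (cast same-length) (lookup-injective sorted-unique _ _ eh≡ek) ⟩
      cast same-length (position k)   ≡⟨ cast-involutive same-length (sym same-length) k ⟩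
      k                               ∎
      where open ≡-Reasoning

    e-in-J : ∀ k → J (e k)
    e-in-J k = proj₂ (∈-filter⁻ J? {xs = allFin m} (∈-resp-↭ (sort-↭ members) (∈-lookup (position k))))

    e-onto : ∀ x → J x → ∃ λ k → e k ≡ x
    e-onto x Jx = cast same-length i ,
                  trans (cong (lookup sorted) (cast-involutive (sym same-length) same-length i))
                        (sym (lookup-index x∈sorted))
      where
      x∈sorted : x ∈ sorted
      x∈sorted = ∈-resp-↭ (↭-sym (sort-↭ members)) (∈-filter⁺ J? (∈-allFin x) Jx)
      i : Fin (length sorted)
      i = Any.index x∈sorted

    -- sorted lists are monotone along positions, so a smaller measure forces
    -- a smaller position
    e-monotone : ∀ h k → μ (e h) < μ (e k) → toℕ h < toℕ k
    e-monotone h k μh<μk = decidable-stable (toℕ h <? toℕ k) λ h≮k →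
      <⇒≱ μh<μk (Sorted.lookup-mono-≤ (DecTotalOrder.totalOrder byMeasure) (sort-↗ members)
                   (subst₂ _≤_ (sym (toℕ-cast _ k)) (sym (toℕ-cast _ h)) (≮⇒≥ h≮k)))

module LatticeFacts (L : FiniteLattice) where

  open FiniteLattice L
  open Counting
  open import Data.Fin using (_≟_)
  open import Function using (flip)
  open import Induction.WellFounded using (WellFounded)
  open import Relation.Binary.Lattice.Structures using (IsLattice)
  open import Relation.Binary.PropositionalEquality using (refl; trans)
  open import Relation.Nullary using (¬_)
  open import Relation.Nullary.Decidable using (decidable-stable; _×-dec_; ¬?)
  open IsLattice isLattice public
    using (x≤x∨y; y≤x∨y; ∨-least; x∧y≤x; x∧y≤y; ∧-greatest; antisym)
    renaming (refl to ≤-refl; trans to ≤-trans)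

  <⇒≱ : ∀ {x y} → x < y → ¬ y ≤ x
  <⇒≱ (x≤y , x≢y) y≤x = x≢y (antisym x≤y y≤x)

  ≤∧≱⇒< : ∀ {x y} → x ≤ y → ¬ y ≤ x → x < y
  ≤∧≱⇒< x≤y y≰x = x≤y , λ { refl → y≰x x≤y }

  ≤-<-trans : ∀ {x y z} → x ≤ y → y < z → x < z
  ≤-<-trans x≤y (y≤z , y≢z) = ≤-trans x≤y y≤z , λ { refl → y≢z (antisym y≤z x≤y) }

  ∨-comm : ∀ x y → (x ∨ y) ≡ (y ∨ x)
  ∨-comm x y = antisym (∨-least (y≤x∨y y x) (x≤x∨y y x)) (∨-least (y≤x∨y x y) (x≤x∨y x y))

  meet-below : ∀ {j x} → ¬ j ≤ x → (j ∧ x) < j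
  meet-below {j} {x} j≰x = ≤∧≱⇒< (x∧y≤x j x) (λ j≤j∧x → j≰x (≤-trans j≤j∧x (x∧y≤y j x)))

  down : Fin m → ℕ.ℕ
  down x = count (λ z → z ≤? x)

  down-< : ∀ {x y} → x < y → down x ℕ.< down y
  down-< {x} {y} x<y =
    count-< (λ z → z ≤? x) (λ z → z ≤? y) (λ z≤x → ≤-trans z≤x (proj₁ x<y)) y ≤-refl (<⇒≱ x<y)

  up : Fin m → ℕ.ℕ
  up x = count (λ z → x ≤? z)

  up-< : ∀ {x y} → x < y → up y ℕ.< up x
  up-< {x} {y} x<y = count-< (λ z → y ≤? z) (λ z → x ≤? z) (≤-trans (proj₁ x<y)) x ≤-refl (<⇒≱ x<y)

  <-wellFounded : WellFounded _<_
  <-wellFounded = measure-wellFounded down down-<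

  >-wellFounded : WellFounded (flip _<_)
  >-wellFounded = measure-wellFounded up up-<

  -- Below every y strictly above x there is a lower cover of y above x:
  -- a maximal element of the interval [x , y).
  lower-cover-above : ∀ {x y} → x < y → ∃ λ z → x ≤ z × z ⋖ y
  lower-cover-above {x} {y} x<y
    with minimal >-wellFounded (λ w z → z <? w) (λ z → (x ≤? z) ×-dec (z <? y)) (≤-refl , x<y)
  ... | z , (x≤z , z<y) , maximal =
    z , x≤z , z<y , λ w (z<w , w<y) → maximal w z<w (≤-trans x≤z (proj₁ z<w) , w<y)

  -- An element j ≰ x all of whose lower covers lie below x is join-irreducible:
  -- it has a lower cover c above j ∧ x, and every lower cover is ≤ j ∧ x ≤ c,
  -- hence equal to c.
  irreducible-if-covers-below : ∀ {j x} → ¬ j ≤ x → (∀ w → w ⋖ j → w ≤ x) → JoinIrreducible j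
  irreducible-if-covers-below {j} {x} j≰x covers-below with lower-cover-above (meet-below j≰x)
  ... | c , j∧x≤c , c⋖j =
    trans (length-filter-allFin (λ w → w ⋖? j)) (count-unique (λ w → w ⋖? j) c⋖j only-c)
    where
    only-c : ∀ w → w ⋖ j → w ≡ c
    only-c w w⋖j@(w<j , cover) =
      decidable-stable (w ≟ c) λ w≢c → cover c ((w≤c , w≢c) , proj₁ c⋖j)
      where
      w≤c : w ≤ c
      w≤c = ≤-trans (∧-greatest (proj₁ w<j) (covers-below w w⋖j)) j∧x≤c

  -- If y ≰ x, some join-irreducible below y is not below x: a minimal
  -- element of {j ≤ y , j ≰ x}.
  join-irreducible-witness : ∀ {x y} → ¬ y ≤ x → ∃ λ j → JoinIrreducible j × j ≤ y × ¬ j ≤ x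
  join-irreducible-witness {x} {y} y≰x
    with minimal <-wellFounded _<?_ (λ j → (j ≤? y) ×-dec ¬? (j ≤? x)) (≤-refl , y≰x)
  ... | j , (j≤y , j≰x) , minimality = j , irreducible-if-covers-below j≰x covers-below , j≤y , j≰x
    where
    covers-below : ∀ w → w ⋖ j → w ≤ x
    covers-below w (w<j , _) =
      decidable-stable (w ≤? x) (λ w≰x → minimality w w<j (≤-trans (proj₁ w<j) j≤y , w≰x))

  edges-by-lower-end : edges ≡ sum (λ x → count (λ y → x ⋖? y))
  edges-by-lower-end = length-filter-pairs (λ p → proj₁ p ⋖? proj₂ p)

module Rounds (L : FiniteLattice) {n : ℕ.ℕ} (ι : Fin n → Fin (FiniteLattice.m L)) where

  open FiniteLattice L
  open Counting
  open import Data.Bool using (true; false)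
  open import Data.Nat.ListAction using () renaming (sum to sumList)
  open import Data.Nat.ListAction.Properties using (sum-↭)
  open import Data.List using (List; []; _∷_; _++_; length; filter; map; concatMap; allFin; reverse)
  open import Data.List.Properties using (filter-++)
  open import Data.List.Relation.Binary.Permutation.Propositional.Properties using (↭-reverse; map⁺)
  open import Function using (_∘_)
  open import Relation.Binary.PropositionalEquality using (refl; cong)
  open import Relation.Nullary using (¬_; Dec; yes; no; does; proof; ofʸ; ofⁿ)
  open import Relation.Nullary.Decidable using (_×-dec_; ¬?)

  -- Round k emits "f(x ∨ ι k) ← f(x ∨ ι k) - f(x)" exactly for the x with Step k x.
  Step : Fin n → Fin m → Set
  Step k x = ¬ ι k ≤ x × SamePrefixSpectrum ι k x (x ∨ ι k)

  Step? : ∀ k x → Dec (Step k x)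
  Step? k x = ¬? (ι k ≤? x) ×-dec SamePrefixSpectrum? ι k x (x ∨ ι k)

  no-subtractions-in-assignments : (xs : List (Fin m)) → filter isSub? (map assign xs) ≡ []
  no-subtractions-in-assignments []       = refl
  no-subtractions-in-assignments (x ∷ xs) = no-subtractions-in-assignments xs

  round-unfolds : ∀ k → ∃ λ (emit : Fin m → List (Instr m)) → round L ι k ≡ concatMap emit (allFin m)
  round-unfolds k = _ , refl

  -- Each x contributes the indicator of Step k x.  (The decision of the prefix
  -- spectrum is inspected through its does/proof components, which is how the
  -- local function of round branches on it.)
  emitted-subtractions : ∀ k x (d : Dec (Step k x)) →
                         length (filter isSub? (proj₁ (round-unfolds k) x)) ≡ 𝟙 d
  emitted-subtractions k x d with ι k ≤? x
  ... | yes ιk≤x = sym (𝟙-no d (λ (ιk≰x , _) → ιk≰x ιk≤x))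
  ... | no ιk≰x
    with does (SamePrefixSpectrum? ι k x (x ∨ ι k)) | proof (SamePrefixSpectrum? ι k x (x ∨ ι k))
  ...   | true  | ofʸ same  = sym (𝟙-yes d (ιk≰x , same))
  ...   | false | ofⁿ ¬same = sym (𝟙-no d (¬same ∘ proj₂))

  round-subtractions : ∀ k → length (filter isSub? (round L ι k)) ≡ count (Step? k)
  round-subtractions k = begin
    length (filter isSub? (concatMap emit (allFin m)))
      ≡⟨ length-filter-concatMap isSub? emit (allFin m) ⟩
    sumList (map (λ x → length (filter isSub? (emit x))) (allFin m))
      ≡⟨ sum-allFin (λ x → length (filter isSub? (emit x))) ⟩
    sum (λ x → length (filter isSub? (emit x)))
      ≡⟨ sum-cong-≗ (λ x → emitted-subtractions k x (Step? k x)) ⟩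
    count (Step? k) ∎
    where
    open ≡-Reasoning
    emit : Fin m → List (Instr m)
    emit = proj₁ (round-unfolds k)

  -- The number of subtractions is the number of steps over all rounds; the
  -- order n, n-1, …, 1 of the rounds does not matter for counting.
  subtractions-by-round : numSubtractions L ι ≡ sum (λ k → count (Step? k))
  subtractions-by-round = begin
    length (filter isSub? (map assign (allFin m) ++ concatMap (round L ι) rounds))
      ≡⟨ cong length (filter-++ isSub? (map assign (allFin m)) _) ⟩
    length (filter isSub? (map assign (allFin m)) ++ filter isSub? (concatMap (round L ι) rounds))
      ≡⟨ cong (λ as → length (as ++ filter isSub? (concatMap (round L ι) rounds)))
              (no-subtractions-in-assignments (allFin m)) ⟩
    length (filter isSub? (concatMap (round L ι) rounds))
      ≡⟨ length-filter-concatMap isSub? (round L ι) rounds ⟩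
    sumList (map subtractions rounds)
      ≡⟨ sum-↭ (map⁺ subtractions (↭-reverse (allFin n))) ⟩
    sumList (map subtractions (allFin n))
      ≡⟨ sum-allFin subtractions ⟩
    sum subtractions
      ≡⟨ sum-cong-≗ round-subtractions ⟩
    sum (λ k → count (Step? k)) ∎
    where
    open ≡-Reasoning
    rounds : List (Fin n)
    rounds = reverse (allFin n)
    subtractions : Fin n → ℕ.ℕ
    subtractions k = length (filter isSub? (round L ι k))

module SemimodularSteps (L : FiniteLattice) (semimodular : FiniteLattice.Semimodular L)
  {n : ℕ.ℕ} (ι : Fin n → Fin (FiniteLattice.m L))
  (named : ∀ x → FiniteLattice.JoinIrreducible L x → ∃ λ k → ι k ≡ x)
  (extension : ∀ h k → FiniteLattice._<_ L (ι h) (ι k) → toℕ h ℕ.< toℕ k) where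

  open FiniteLattice L
  open Counting
  open LatticeFacts L
  open Rounds L ι
  open import Data.Nat.Properties using (<-cmp)
  open import Data.Fin using (_≟_)
  open import Data.Fin.Properties using (toℕ-injective)
  open import Function using (id)
  open import Relation.Binary.Definitions using (tri<; tri≈; tri>)
  open import Relation.Binary.PropositionalEquality using (refl; subst)
  open import Relation.Nullary using (contradiction)
  open import Relation.Nullary.Decidable using (decidable-stable; _×-dec_; ¬?)

  -- Under a step at x for k, a join-irreducible j < ι k lies below x: j is
  -- named before ι k and j ≤ x ∨ ι k, so the prefix spectra give j ≤ x.
  smaller-irreducible-below : ∀ {k x j} → Step k x → JoinIrreducible j → j < ι k → j ≤ x
  smaller-irreducible-below {k} {x} (_ , same) irreducible j<ιk with named _ irreducible
  ... | h , refl = proj₂ (same h (extension h k j<ιk)) (≤-trans (proj₁ j<ιk) (y≤x∨y x (ι k)))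

  -- With i = ι k, the lower cover z of i above i ∧ x
  -- lies below x, since otherwise a join-irreducible j ≤ z with j ≰ x would
  -- contradict smaller-irreducible-below.  Hence i ∧ x ⋖ i, and
  -- semimodularity gives x ⋖ i ∨ x.
  step-is-cover : ∀ {k x} → Step k x → x ⋖ (x ∨ ι k)
  step-is-cover {k} {x} step@(i≰x , _) with lower-cover-above (meet-below i≰x)
  ... | z , i∧x≤z , z⋖i@(z<i , _) = subst (x ⋖_) (∨-comm (ι k) x) (semimodular (ι k) x i∧x⋖i)
    where
    z≤x : z ≤ x
    z≤x = decidable-stable (z ≤? x) λ z≰x →
      let j , irreducible , j≤z , j≰x = join-irreducible-witness z≰x
      in j≰x (smaller-irreducible-below step irreducible (≤-<-trans j≤z z<i))
    i∧x⋖i : (ι k ∧ x) ⋖ ι k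
    i∧x⋖i = subst (_⋖ ι k) (antisym (∧-greatest (proj₁ z<i) z≤x) i∧x≤z) z⋖i

  -- Every cover x ⋖ y is reached by a step: take the join-irreducible of
  -- least name among those below y but not below x.
  cover-is-step : ∀ {x y} → x ⋖ y → ∃ λ k → Step k x × (x ∨ ι k) ≡ y
  cover-is-step {x} {y} ((x≤y , x≢y) , cover)
    with join-irreducible-witness (λ y≤x → x≢y (antisym x≤y y≤x))
  ... | j , irreducible , j≤y , j≰x
    with named j irreducible
  ... | h , refl
    with minimal (measure-wellFounded toℕ id) (λ h k → toℕ h ℕ.<? toℕ k)
                 (λ k → (ι k ≤? y) ×-dec ¬? (ι k ≤? x)) (j≤y , j≰x)
  ... | k , (ιk≤y , ιk≰x) , least = k , (ιk≰x , same) , x∨ιk≡y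
    where
    x∨ιk≤y : (x ∨ ι k) ≤ y
    x∨ιk≤y = ∨-least x≤y ιk≤y
    x<x∨ιk : x < (x ∨ ι k)
    x<x∨ιk = ≤∧≱⇒< (x≤x∨y x (ι k)) (λ x∨ιk≤x → ιk≰x (≤-trans (y≤x∨y x (ι k)) x∨ιk≤x))
    x∨ιk≡y : (x ∨ ι k) ≡ y
    x∨ιk≡y = decidable-stable ((x ∨ ι k) ≟ y) λ x∨ιk≢y → cover (x ∨ ι k) (x<x∨ιk , x∨ιk≤y , x∨ιk≢y)
    same : SamePrefixSpectrum ι k x (x ∨ ι k)
    same h h<k = (λ ιh≤x → ≤-trans ιh≤x (x≤x∨y x (ι k))) ,
                 (λ ιh≤x∨ιk → decidable-stable (ι h ≤? x) λ ιh≰x →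
                    least h h<k (≤-trans ιh≤x∨ιk x∨ιk≤y , ιh≰x))

  -- Two steps at x reaching the same element coincide: the step with the
  -- larger name would see the other join-irreducible in its prefix spectrum.
  step-injective : ∀ {x k k′} → Step k x → Step k′ x → (x ∨ ι k) ≡ (x ∨ ι k′) → k ≡ k′
  step-injective {x} {k} {k′} (ιk≰x , same) (ιk′≰x , same′) joins-equal with <-cmp (toℕ k) (toℕ k′)
  ... | tri< k<k′ _ _ =
    contradiction (proj₂ (same′ k k<k′) (subst (ι k ≤_) joins-equal (y≤x∨y x (ι k)))) ιk≰x
  ... | tri≈ _ k≡k′ _ = toℕ-injective k≡k′
  ... | tri> _ _ k′<k =
    contradiction (proj₂ (same k′ k′<k) (subst (ι k′ ≤_) (sym joins-equal) (y≤x∨y x (ι k′)))) ιk′≰x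

  covers-are-steps : ∀ x → count (λ y → x ⋖? y) ≡ count (λ k → Step? k x)
  covers-are-steps x = count-bijection (λ k → Step? k x) (λ y → x ⋖? y) (λ k → x ∨ ι k)
    step-is-cover cover-is-step step-injective

  covers-are-all-steps : sum (λ x → count (λ y → x ⋖? y)) ≡ sum (λ k → count (Step? k))
  covers-are-all-steps = begin
    sum (λ x → count (λ y → x ⋖? y))        ≡⟨ sum-cong-≗ covers-are-steps ⟩
    sum (λ x → sum (λ k → 𝟙 (Step? k x)))   ≡⟨ ∑-comm (λ x k → 𝟙 (Step? k x)) ⟩
    sum (λ k → count (Step? k))             ∎
    where open ≡-Reasoning

record LinearNaming (L : FiniteLattice) : Set where
  open FiniteLattice L
  field
    ι         : Fin numJI → Fin m
    isNaming  : IsNaming numJI ι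
    extension : ∀ h k → ι h < ι k → toℕ h ℕ.< toℕ k

-- Sorting the join-irreducibles by the size of their down-sets gives one,
-- since down-set sizes strictly increase along the order.
linear-naming : (L : FiniteLattice) → LinearNaming L
linear-naming L = naming (Enumeration.sorted-enumeration JoinIrreducible? down)
  where
  open FiniteLattice L
  open LatticeFacts L using (down; down-<)
  naming : (∃ λ (e : Fin numJI → Fin m) →
             IsNaming numJI e × (∀ h k → down (e h) ℕ.< down (e k) → toℕ h ℕ.< toℕ k)) →
           LinearNaming L
  naming (e , isNaming , by-size) = record
    { ι         = e
    ; isNaming  = isNaming
    ; extension = λ h k eh<ek → by-size h k (down-< eh<ek)
    }

theorem3 : (L : FiniteLattice) → FiniteLattice.Semimodular L →
    ∃ λ (ι : Fin (FiniteLattice.numJI L) → Fin (FiniteLattice.m L)) →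
      FiniteLattice.IsNaming L (FiniteLattice.numJI L) ι × numSubtractions L ι ≡ FiniteLattice.edges L
theorem3 L semimodular = ι , isNaming , subtractions≡edges
  where
  open FiniteLattice L
  open LinearNaming (linear-naming L)
  open Counting using (sum; count)
  open LatticeFacts L using (edges-by-lower-end)
  open Rounds L ι using (Step?; subtractions-by-round)
  open SemimodularSteps L semimodular ι (proj₂ (proj₂ isNaming)) extension using (covers-are-all-steps)
  open ≡-Reasoning
  subtractions≡edges : numSubtractions L ι ≡ edges
  subtractions≡edges = begin
    numSubtractions L ι                 ≡⟨ subtractions-by-round ⟩
    sum (λ k → count (Step? k))         ≡⟨ sym covers-are-all-steps ⟩
    sum (λ x → count (λ y → x ⋖? y))    ≡⟨ sym edges-by-lower-end ⟩
    edges                               ∎
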